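{- For all integers $n\ge 1$ and $k\ge 1$, $$\sum_{\substack{i=1\\ i\ne k}}^{\infty}\frac{1}{i^{2n}(k-i)}=\frac{H_k}{k^{2n}}-\frac{2n+1}{k^{2n+1}}+\sum_{i=1}^{2n-1}\frac{\zeta(2n+1-i)}{k^{i}}.$$
   Context: $H_k=\sum_{i=1}^k\frac1i$ is the $k$-th harmonic number and $\zeta$ is the Riemann zeta function. -}

module Defs where

open import Data.Nat using (ℕ; zero; suc; _^_; _≟_; _≤_)
open import Data.Integer using (ℤ; +_; -[1+_]) renaming (_-_ to _-ℤ_)
open import Data.Rational using (ℚ; 0ℚ; _+_; _*_; _-_; _/_; ∣_∣; _<_) renaming (_≤_ to _≤ℚ_)
open import Data.Product using (∃-syntax)
open import Relation.Nullary using (yes; no)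

-- reciprocal of a natural number as a rational (value at 0 is a junk 0, never used)
recipℕ : ℕ → ℚ
recipℕ zero    = 0ℚ
recipℕ (suc n) = + 1 / suc n

recipℤ : ℤ → ℚ
recipℤ (+ n)      = recipℕ n
recipℤ -[1+ n ]   = -[1+ 0 ] / suc n

sumFrom1 : (ℕ → ℚ) → ℕ → ℚ
sumFrom1 f zero    = 0ℚ
sumFrom1 f (suc N) = sumFrom1 f N + f (suc N)

H : ℕ → ℚ
H k = sumFrom1 recipℕ k

-- partial sums of ζ(s): Σ_{i=1}^N 1/i^s   (the real ζ(s), s ≥ 2, is the limit)
zetaPartial : ℕ → ℕ → ℚ
zetaPartial s N = sumFrom1 (λ i → recipℕ (i ^ s)) N

-- Cauchy reals: a real is given by a Cauchy sequence of rationals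
IsCauchy : (ℕ → ℚ) → Set
IsCauchy a = ∀ (ε : ℚ) → 0ℚ < ε → ∃[ M ] (∀ N N′ → M ≤ N → M ≤ N′ → ∣ a N - a N′ ∣ ≤ℚ ε)

-- equality of the reals represented by two sequences
_≈ℝ_ : (ℕ → ℚ) → (ℕ → ℚ) → Set
a ≈ℝ b = ∀ (ε : ℚ) → 0ℚ < ε → ∃[ M ] (∀ N → M ≤ N → ∣ a N - b N ∣ ≤ℚ ε)

-- summand of the LHS: 1 / (i^{2n} (k - i)) for i ≠ k, and 0 for i = k (excluded index)
lhsTerm : ℕ → ℕ → ℕ → ℚ
lhsTerm n k i with i ≟ k
... | yes _ = 0ℚ
... | no  _ = recipℕ (i ^ (2 Data.Nat.* n)) * recipℤ (+ k -ℤ + i)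

lhsPartial : ℕ → ℕ → ℕ → ℚ
lhsPartial n k N = sumFrom1 (lhsTerm n k) N

-- RHS with each ζ(2n+1-i) replaced by its N-th partial sum
rhsApprox : ℕ → ℕ → ℕ → ℚ
rhsApprox n k N =
  (H k * recipℕ (k ^ (2 Data.Nat.* n)))
  - ((+ (2 Data.Nat.* n Data.Nat.+ 1) / 1) * recipℕ (k ^ (2 Data.Nat.* n Data.Nat.+ 1)))
  + sumFrom1 (λ i → zetaPartial (2 Data.Nat.* n Data.Nat.+ 1 Data.Nat.∸ i) N * recipℕ (k ^ i))
             (2 Data.Nat.* n Data.Nat.∸ 1)

-- Put m = 2n. For i ≠ k the numbers x = 1/i, y = 1/k and r = 1/(k − i) satisfy r (x − y) = x y, and
-- iterating x r = y (x + r) gives the partial fraction expansion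
--   1/(i^m (k − i)) = Σ_{j=1}^{m−1} 1/(i^{m+1−j} k^j) + (1/k^m) (1/i + 1/(k − i)).
-- Summed over i ≤ N, the first part is exactly the rhs with every ζ(m+1−j) truncated at N. For N = a + k
-- the remaining residual terms add up to H_k/k^m − (m+1)/k^{m+1} + (H_{a+k} − H_a)/k^m: the terms i < k
-- pair up into 2 H_{k−1}, the excluded index i = k leaves −(m−1)/k^{m+1}, and 1/i − 1/(i − k) telescopes
-- for i > k. So both partial sums differ by at most k/(a+1). Beyond k the partial sums of the left side
-- decrease by 1/(i^m (i − k)) ≤ 1/(b+1) − 1/(b+2) at i = k+b+1, hence form a Cauchy sequence.

module Submission where

open import Defs
open import Data.Nat using (ℕ; _≥_)
open import Data.Product using (_×_)
open import Data.Product using (_,_; proj₁; proj₂; ∃-syntax)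
open import Data.Nat as ℕ using (zero; suc)
import Data.Nat.Properties as ℕ
open import Data.Nat.Coprimality using (1-coprimeTo) renaming (sym to coprime-sym)
open import Data.Integer as ℤ using (+_; -[1+_])
import Data.Integer.Properties as ℤ
open import Data.Integer.Tactic.RingSolver using (solve-∀)
open import Data.Rational hiding (_≥_; NonZero)
open import Data.Rational.Properties
import Data.Rational.Unnormalised.Base as ℚᵘ
import Data.Rational.Unnormalised.Properties as ℚᵘ
open import Data.Rational.Solver using (module +-*-Solver)
open import Algebra.Definitions.RawSemiring +-*-rawSemiring using (_^_)
open import Data.Sum using (inj₁; inj₂)
open import Data.Empty using (⊥-elim)
open import Relation.Nullary using (yes; no)
open import Relation.Binary.Definitions using (tri<; tri≈; tri>)
open import Relation.Binary.PropositionalEquality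
open ≡-Reasoning
open +-*-Solver

fromℕ : ℕ → ℚ
fromℕ n = + n / 1

fromℕ≡mkℚ : ∀ a → fromℕ a ≡ mkℚ (+ a) 0 (coprime-sym (1-coprimeTo a))
fromℕ≡mkℚ a = normalize-coprime (coprime-sym (1-coprimeTo a))

recipℕ≡mkℚ : ∀ a → recipℕ (suc a) ≡ mkℚ (+ 1) a (1-coprimeTo (suc a))
recipℕ≡mkℚ a = normalize-coprime (1-coprimeTo (suc a))

fromℕ-suc : ∀ a → fromℕ (suc a) ≡ fromℕ a + 1ℚ
fromℕ-suc a rewrite fromℕ≡mkℚ (suc a) | fromℕ≡mkℚ a =
  toℚᵘ-injective (ℚᵘ.≃-sym (ℚᵘ.≃-trans (toℚᵘ-homo-+ (mkℚ (+ a) 0 (coprime-sym (1-coprimeTo a))) 1ℚ) (ℚᵘ.*≡* (cross (+ a)))))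
  where
  cross : ∀ z → (z ℤ.* + 1 ℤ.+ + 1 ℤ.* + 1) ℤ.* + 1 ≡ (+ 1 ℤ.+ z) ℤ.* (+ 1 ℤ.* + 1)
  cross = solve-∀

fromℕ-+ : ∀ a b → fromℕ (a ℕ.+ b) ≡ fromℕ a + fromℕ b
fromℕ-+ zero    b = sym (+-identityˡ (fromℕ b))
fromℕ-+ (suc a) b = begin
  fromℕ (suc (a ℕ.+ b))   ≡⟨ fromℕ-suc (a ℕ.+ b) ⟩
  fromℕ (a ℕ.+ b) + 1ℚ    ≡⟨ cong (_+ 1ℚ) (fromℕ-+ a b) ⟩
  fromℕ a + fromℕ b + 1ℚ  ≡⟨ solve 2 (λ x y → x :+ y :+ con 1ℚ := x :+ con 1ℚ :+ y) refl (fromℕ a) (fromℕ b) ⟩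
  fromℕ a + 1ℚ + fromℕ b  ≡⟨ cong (_+ fromℕ b) (fromℕ-suc a) ⟨
  fromℕ (suc a) + fromℕ b ∎

fromℕ-* : ∀ a b → fromℕ (a ℕ.* b) ≡ fromℕ a * fromℕ b
fromℕ-* zero    b = sym (*-zeroˡ (fromℕ b))
fromℕ-* (suc a) b = begin
  fromℕ (b ℕ.+ a ℕ.* b)       ≡⟨ fromℕ-+ b (a ℕ.* b) ⟩
  fromℕ b + fromℕ (a ℕ.* b)   ≡⟨ cong (λ c → fromℕ b + c) (fromℕ-* a b) ⟩
  fromℕ b + fromℕ a * fromℕ b ≡⟨ solve 2 (λ x y → y :+ x :* y := (x :+ con 1ℚ) :* y) refl (fromℕ a) (fromℕ b) ⟩
  (fromℕ a + 1ℚ) * fromℕ b    ≡⟨ cong (_* fromℕ b) (fromℕ-suc a) ⟨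
  fromℕ (suc a) * fromℕ b     ∎

fromℕ-∸ : ∀ {a b} → b ℕ.≤ a → fromℕ (a ℕ.∸ b) ≡ fromℕ a - fromℕ b
fromℕ-∸ {a} {b} b≤a = begin
  fromℕ (a ℕ.∸ b)                       ≡⟨ solve 2 (λ x y → x := x :+ y :- y) refl (fromℕ (a ℕ.∸ b)) (fromℕ b) ⟩
  fromℕ (a ℕ.∸ b) + fromℕ b - fromℕ b   ≡⟨ cong (_- fromℕ b) (fromℕ-+ (a ℕ.∸ b) b) ⟨
  fromℕ (a ℕ.∸ b ℕ.+ b) - fromℕ b       ≡⟨ cong (λ c → fromℕ c - fromℕ b) (ℕ.m∸n+n≡m b≤a) ⟩
  fromℕ a - fromℕ b                     ∎

fromℕ-nonNeg : ∀ a → 0ℚ ≤ fromℕ a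
fromℕ-nonNeg a rewrite fromℕ≡mkℚ a = *≤* (subst (+ 0 ℤ.≤_) (sym (ℤ.*-identityʳ (+ a))) (ℤ.+≤+ ℕ.z≤n))

recipℕ-inverseˡ : ∀ a .{{_ : ℕ.NonZero a}} → recipℕ a * fromℕ a ≡ 1ℚ
recipℕ-inverseˡ (suc a) rewrite recipℕ≡mkℚ a | fromℕ≡mkℚ (suc a) = *-inverseˡ (mkℚ (+ suc a) 0 (coprime-sym (1-coprimeTo (suc a))))

recipℕ-unique : ∀ a .{{_ : ℕ.NonZero a}} x → x * fromℕ a ≡ 1ℚ → x ≡ recipℕ a
recipℕ-unique a x x*a≡1 = begin
  x                            ≡⟨ *-identityʳ x ⟨
  x * 1ℚ                       ≡⟨ cong (x *_) (recipℕ-inverseˡ a) ⟨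
  x * (recipℕ a * fromℕ a)     ≡⟨ solve 3 (λ x r a → x :* (r :* a) := (x :* a) :* r) refl x (recipℕ a) (fromℕ a) ⟩
  (x * fromℕ a) * recipℕ a     ≡⟨ cong (_* recipℕ a) x*a≡1 ⟩
  1ℚ * recipℕ a                ≡⟨ *-identityˡ (recipℕ a) ⟩
  recipℕ a                     ∎

recipℕ-* : ∀ a b → recipℕ (a ℕ.* b) ≡ recipℕ a * recipℕ b
recipℕ-* zero    b = sym (*-zeroˡ (recipℕ b))
recipℕ-* (suc a) zero rewrite ℕ.*-zeroʳ a = sym (*-zeroʳ (recipℕ (suc a)))
recipℕ-* a@(suc _) b@(suc _) = sym (recipℕ-unique (a ℕ.* b) (recipℕ a * recipℕ b) (begin
  recipℕ a * recipℕ b * fromℕ (a ℕ.* b)             ≡⟨ cong (recipℕ a * recipℕ b *_) (fromℕ-* a b) ⟩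
  recipℕ a * recipℕ b * (fromℕ a * fromℕ b)         ≡⟨ solve 4 (λ x y u v → x :* y :* (u :* v) := (x :* u) :* (y :* v)) refl (recipℕ a) (recipℕ b) (fromℕ a) (fromℕ b) ⟩
  (recipℕ a * fromℕ a) * (recipℕ b * fromℕ b)       ≡⟨ cong₂ _*_ (recipℕ-inverseˡ a) (recipℕ-inverseˡ b) ⟩
  1ℚ                                                ∎))

recipℕ-^ : ∀ a e → recipℕ (a ℕ.^ e) ≡ recipℕ a ^ e
recipℕ-^ a zero    = refl
recipℕ-^ a (suc e) = trans (recipℕ-* a (a ℕ.^ e)) (cong (recipℕ a *_) (recipℕ-^ a e))

recipℕ-nonNeg : ∀ a → 0ℚ ≤ recipℕ a
recipℕ-nonNeg zero    = ≤-refl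
recipℕ-nonNeg (suc a) rewrite recipℕ≡mkℚ a = *≤* (ℤ.+≤+ ℕ.z≤n)

recipℕ-antimono : ∀ {a b} → 1 ℕ.≤ b → b ℕ.≤ a → recipℕ a ≤ recipℕ b
recipℕ-antimono {suc a} {suc b} _ b≤a rewrite recipℕ≡mkℚ a | recipℕ≡mkℚ b =
  *≤* (subst₂ ℤ._≤_ (sym (ℤ.*-identityˡ (+ suc b))) (sym (ℤ.*-identityˡ (+ suc a))) (ℤ.+≤+ b≤a))

recipℕ≤1 : ∀ a → recipℕ a ≤ 1ℚ
recipℕ≤1 zero    = *≤* (ℤ.+≤+ ℕ.z≤n)
recipℕ≤1 (suc a) = recipℕ-antimono {suc a} {1} ℕ.z<s ℕ.z<s

*-nonNeg : ∀ {p q} → 0ℚ ≤ p → 0ℚ ≤ q → 0ℚ ≤ p * q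
*-nonNeg {p} {q} p≥0 q≥0 = nonNegative⁻¹ (p * q) {{nonNeg*nonNeg⇒nonNeg p {{nonNegative p≥0}} q {{nonNegative q≥0}}}}

∣p-q∣≡∣q-p∣ : ∀ p q → ∣ p - q ∣ ≡ ∣ q - p ∣
∣p-q∣≡∣q-p∣ p q = trans (sym (∣-p∣≡∣p∣ (p - q))) (cong ∣_∣ (solve 2 (λ p q → :- (p :- q) := q :- p) refl p q))

recipℤ-neg : ∀ a → recipℤ (ℤ.- + a) ≡ - recipℕ a
recipℤ-neg zero    = refl
recipℤ-neg (suc a) = refl

recipℤ[+m-+n]≡recipℕ[m∸n] : ∀ {m n} → n ℕ.≤ m → recipℤ (+ m ℤ.- + n) ≡ recipℕ (m ℕ.∸ n)
recipℤ[+m-+n]≡recipℕ[m∸n] {m} {n} n≤m rewrite ℤ.[+m]-[+n]≡m⊖n m n | ℤ.⊖-≥ n≤m = refl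

recipℤ[+m-+n]≡-recipℕ[n∸m] : ∀ {m n} → m ℕ.≤ n → recipℤ (+ m ℤ.- + n) ≡ - recipℕ (n ℕ.∸ m)
recipℤ[+m-+n]≡-recipℕ[n∸m] {m} {n} m≤n rewrite ℤ.[+m]-[+n]≡m⊖n m n | ℤ.⊖-≤ m≤n = recipℤ-neg (n ℕ.∸ m)

recipℤ[+m-+n]*[m-n]≡1 : ∀ {m n} → m ≢ n → recipℤ (+ m ℤ.- + n) * (fromℕ m - fromℕ n) ≡ 1ℚ
recipℤ[+m-+n]*[m-n]≡1 {m} {n} m≢n with ℕ.<-cmp m n
... | tri≈ _ m≡n _ = ⊥-elim (m≢n m≡n)
... | tri> _ _ n<m = begin
  recipℤ (+ m ℤ.- + n) * (fromℕ m - fromℕ n) ≡⟨ cong₂ _*_ (recipℤ[+m-+n]≡recipℕ[m∸n] (ℕ.<⇒≤ n<m)) (sym (fromℕ-∸ (ℕ.<⇒≤ n<m))) ⟩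
  recipℕ (m ℕ.∸ n) * fromℕ (m ℕ.∸ n)       ≡⟨ recipℕ-inverseˡ (m ℕ.∸ n) {{ℕ.>-nonZero (ℕ.m<n⇒0<n∸m n<m)}} ⟩
  1ℚ                                        ∎
... | tri< m<n _ _ = begin
  recipℤ (+ m ℤ.- + n) * (fromℕ m - fromℕ n)      ≡⟨ cong (_* (fromℕ m - fromℕ n)) (recipℤ[+m-+n]≡-recipℕ[n∸m] (ℕ.<⇒≤ m<n)) ⟩
  - recipℕ (n ℕ.∸ m) * (fromℕ m - fromℕ n)        ≡⟨ solve 3 (λ r a b → (:- r) :* (a :- b) := r :* (b :- a)) refl (recipℕ (n ℕ.∸ m)) (fromℕ m) (fromℕ n) ⟩
  recipℕ (n ℕ.∸ m) * (fromℕ n - fromℕ m)          ≡⟨ cong (recipℕ (n ℕ.∸ m) *_) (fromℕ-∸ (ℕ.<⇒≤ m<n)) ⟨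
  recipℕ (n ℕ.∸ m) * fromℕ (n ℕ.∸ m)              ≡⟨ recipℕ-inverseˡ (n ℕ.∸ m) {{ℕ.>-nonZero (ℕ.m<n⇒0<n∸m m<n)}} ⟩
  1ℚ                                               ∎

r*[x-y]≡x*y : ∀ x y r {a b} → x * a ≡ 1ℚ → y * b ≡ 1ℚ → r * (b - a) ≡ 1ℚ → r * (x - y) ≡ x * y
r*[x-y]≡x*y x y r {a} {b} x*a≡1 y*b≡1 r*[b-a]≡1 = begin
  r * (x - y)                     ≡⟨ cong₂ (λ u v → r * (u - v)) (trans (cong (x *_) y*b≡1) (*-identityʳ x)) (trans (cong (y *_) x*a≡1) (*-identityʳ y)) ⟨
  r * (x * (y * b) - y * (x * a)) ≡⟨ solve 5 (λ x y a b r → r :* (x :* (y :* b) :- y :* (x :* a)) := x :* y :* (r :* (b :- a))) refl x y a b r ⟩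
  x * y * (r * (b - a))           ≡⟨ cong (x * y *_) r*[b-a]≡1 ⟩
  x * y * 1ℚ                      ≡⟨ *-identityʳ (x * y) ⟩
  x * y                           ∎

recipℤ[k-i]*[1/i-1/k]≡1/i*1/k : ∀ {i k} .{{_ : ℕ.NonZero i}} .{{_ : ℕ.NonZero k}} → i ≢ k →
  recipℤ (+ k ℤ.- + i) * (recipℕ i - recipℕ k) ≡ recipℕ i * recipℕ k
recipℤ[k-i]*[1/i-1/k]≡1/i*1/k {i} {k} i≢k =
  r*[x-y]≡x*y (recipℕ i) (recipℕ k) (recipℤ (+ k ℤ.- + i)) (recipℕ-inverseˡ i) (recipℕ-inverseˡ k) (recipℤ[+m-+n]*[m-n]≡1 (≢-sym i≢k))

recipℕ-telescope : ∀ s → recipℕ (suc s) * recipℕ (suc (suc s)) ≡ recipℕ (suc s) - recipℕ (suc (suc s))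
recipℕ-telescope s = begin
  recipℕ (suc s) * recipℕ (suc (suc s))                                  ≡⟨ recipℤ[k-i]*[1/i-1/k]≡1/i*1/k (ℕ.<⇒≢ (ℕ.n<1+n (suc s))) ⟨
  recipℤ (+ suc (suc s) ℤ.- + suc s) * (recipℕ (suc s) - recipℕ (suc (suc s))) ≡⟨ cong (_* (recipℕ (suc s) - recipℕ (suc (suc s)))) 1/[s+2-[s+1]]≡1 ⟩
  1ℚ * (recipℕ (suc s) - recipℕ (suc (suc s)))                          ≡⟨ *-identityˡ _ ⟩
  recipℕ (suc s) - recipℕ (suc (suc s))                                  ∎
  where
  1/[s+2-[s+1]]≡1 : recipℤ (+ suc (suc s) ℤ.- + suc s) ≡ 1ℚ
  1/[s+2-[s+1]]≡1 = trans (recipℤ[+m-+n]≡recipℕ[m∸n] (ℕ.n≤1+n (suc s))) (cong recipℕ (ℕ.m+n∸n≡m 1 (suc s)))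

sumFrom1-cong : ∀ {f g : ℕ → ℚ} N → (∀ i → 1 ℕ.≤ i → i ℕ.≤ N → f i ≡ g i) → sumFrom1 f N ≡ sumFrom1 g N
sumFrom1-cong zero    f≡g = refl
sumFrom1-cong (suc N) f≡g =
  cong₂ _+_ (sumFrom1-cong N (λ i 1≤i i≤N → f≡g i 1≤i (ℕ.m≤n⇒m≤1+n i≤N))) (f≡g (suc N) ℕ.z<s ℕ.≤-refl)

sumFrom1-+ : ∀ (f g : ℕ → ℚ) N → sumFrom1 (λ i → f i + g i) N ≡ sumFrom1 f N + sumFrom1 g N
sumFrom1-+ f g zero    = refl
sumFrom1-+ f g (suc N) = trans (cong (_+ (f (suc N) + g (suc N))) (sumFrom1-+ f g N))
  (solve 4 (λ a b c d → (a :+ b) :+ (c :+ d) := (a :+ c) :+ (b :+ d)) refl (sumFrom1 f N) (sumFrom1 g N) (f (suc N)) (g (suc N)))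

sumFrom1-difference : ∀ (f g : ℕ → ℚ) N → sumFrom1 (λ i → f i - g i) N ≡ sumFrom1 f N - sumFrom1 g N
sumFrom1-difference f g zero    = refl
sumFrom1-difference f g (suc N) = trans (cong (_+ (f (suc N) - g (suc N))) (sumFrom1-difference f g N))
  (solve 4 (λ a b c d → (a :- b) :+ (c :- d) := (a :+ c) :- (b :+ d)) refl (sumFrom1 f N) (sumFrom1 g N) (f (suc N)) (g (suc N)))

*-distribˡ-sumFrom1 : ∀ c (f : ℕ → ℚ) N → c * sumFrom1 f N ≡ sumFrom1 (λ i → c * f i) N
*-distribˡ-sumFrom1 c f zero    = *-zeroʳ c
*-distribˡ-sumFrom1 c f (suc N) =
  trans (*-distribˡ-+ c (sumFrom1 f N) (f (suc N))) (cong (_+ c * f (suc N)) (*-distribˡ-sumFrom1 c f N))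

*-distribʳ-sumFrom1 : ∀ c (f : ℕ → ℚ) N → sumFrom1 f N * c ≡ sumFrom1 (λ i → f i * c) N
*-distribʳ-sumFrom1 c f N =
  trans (*-comm (sumFrom1 f N) c) (trans (*-distribˡ-sumFrom1 c f N) (sumFrom1-cong N (λ i _ _ → *-comm c (f i))))

sumFrom1-const : ∀ c N → sumFrom1 (λ _ → c) N ≡ fromℕ N * c
sumFrom1-const c zero    = sym (*-zeroˡ c)
sumFrom1-const c (suc N) = begin
  sumFrom1 (λ _ → c) N + c ≡⟨ cong (_+ c) (sumFrom1-const c N) ⟩
  fromℕ N * c + c          ≡⟨ solve 2 (λ x c → x :* c :+ c := (x :+ con 1ℚ) :* c) refl (fromℕ N) c ⟩
  (fromℕ N + 1ℚ) * c       ≡⟨ cong (_* c) (fromℕ-suc N) ⟨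
  fromℕ (suc N) * c        ∎

sumFrom1-comm : ∀ (G : ℕ → ℕ → ℚ) N L →
  sumFrom1 (λ j → sumFrom1 (λ i → G i j) N) L ≡ sumFrom1 (λ i → sumFrom1 (G i) L) N
sumFrom1-comm G zero    L = trans (sumFrom1-const 0ℚ L) (*-zeroʳ (fromℕ L))
sumFrom1-comm G (suc N) L = begin
  sumFrom1 (λ j → sumFrom1 (λ i → G i j) N + G (suc N) j) L            ≡⟨ sumFrom1-+ (λ j → sumFrom1 (λ i → G i j) N) (G (suc N)) L ⟩
  sumFrom1 (λ j → sumFrom1 (λ i → G i j) N) L + sumFrom1 (G (suc N)) L ≡⟨ cong (_+ sumFrom1 (G (suc N)) L) (sumFrom1-comm G N L) ⟩
  sumFrom1 (λ i → sumFrom1 (G i) L) N + sumFrom1 (G (suc N)) L         ∎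

sumFrom1-shift : ∀ (f : ℕ → ℚ) N → sumFrom1 (λ i → f (suc i)) N + f 1 ≡ sumFrom1 f N + f (suc N)
sumFrom1-shift f zero    = trans (+-identityˡ (f 1)) (sym (+-identityˡ (f 1)))
sumFrom1-shift f (suc N) = begin
  sumFrom1 (λ i → f (suc i)) N + f (2 ℕ.+ N) + f 1 ≡⟨ solve 3 (λ a b c → a :+ b :+ c := a :+ c :+ b) refl (sumFrom1 (λ i → f (suc i)) N) (f (2 ℕ.+ N)) (f 1) ⟩
  sumFrom1 (λ i → f (suc i)) N + f 1 + f (2 ℕ.+ N) ≡⟨ cong (_+ f (2 ℕ.+ N)) (sumFrom1-shift f N) ⟩
  sumFrom1 f (suc N) + f (2 ℕ.+ N)                 ∎

sumFrom1-reverse : ∀ (f : ℕ → ℚ) N → sumFrom1 f N ≡ sumFrom1 (λ i → f (suc N ℕ.∸ i)) N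
sumFrom1-reverse f zero    = refl
sumFrom1-reverse f (suc N) = begin
  sumFrom1 f N + f (suc N)                          ≡⟨ sumFrom1-shift f N ⟨
  sumFrom1 (λ i → f (suc i)) N + f 1                ≡⟨ cong (_+ f 1) (sumFrom1-reverse (λ i → f (suc i)) N) ⟩
  sumFrom1 (λ i → f (suc (suc N ℕ.∸ i))) N + f 1    ≡⟨ cong₂ _+_ (sumFrom1-cong N (λ i _ i≤N → cong f (ℕ.+-∸-assoc 1 (ℕ.m≤n⇒m≤1+n i≤N)))) (cong f (ℕ.m+n∸n≡m 1 N)) ⟨
  sumFrom1 (λ i → f (2 ℕ.+ N ℕ.∸ i)) N + f (2 ℕ.+ N ℕ.∸ suc N) ∎

sumFrom1-mono-≤ : ∀ {f g : ℕ → ℚ} N → (∀ i → 1 ℕ.≤ i → i ℕ.≤ N → f i ≤ g i) → sumFrom1 f N ≤ sumFrom1 g N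
sumFrom1-mono-≤ zero    f≤g = ≤-refl
sumFrom1-mono-≤ (suc N) f≤g =
  +-mono-≤ (sumFrom1-mono-≤ N (λ i 1≤i i≤N → f≤g i 1≤i (ℕ.m≤n⇒m≤1+n i≤N))) (f≤g (suc N) ℕ.z<s ℕ.≤-refl)

sumFrom1-nonNeg : ∀ (f : ℕ → ℚ) N → (∀ i → 1 ℕ.≤ i → i ℕ.≤ N → 0ℚ ≤ f i) → 0ℚ ≤ sumFrom1 f N
sumFrom1-nonNeg f N f≥0 = subst (_≤ sumFrom1 f N) (trans (sumFrom1-const 0ℚ N) (*-zeroʳ (fromℕ N))) (sumFrom1-mono-≤ N f≥0)

sumFrom1-≤ : ∀ (f : ℕ → ℚ) c N → (∀ i → 1 ℕ.≤ i → i ℕ.≤ N → f i ≤ c) → sumFrom1 f N ≤ fromℕ N * c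
sumFrom1-≤ f c N f≤c = subst (sumFrom1 f N ≤_) (sumFrom1-const c N) (sumFrom1-mono-≤ N f≤c)

sumFrom1-recipℤ[k-i]≡H : ∀ K → sumFrom1 (λ i → recipℤ (+ suc K ℤ.- + i)) K ≡ H K
sumFrom1-recipℤ[k-i]≡H K = begin
  sumFrom1 (λ i → recipℤ (+ suc K ℤ.- + i)) K                  ≡⟨ sumFrom1-reverse _ K ⟩
  sumFrom1 (λ i → recipℤ (+ suc K ℤ.- + (suc K ℕ.∸ i))) K      ≡⟨ sumFrom1-cong K recipℤ[k-[k-i]]≡recipℕ ⟩
  H K                                                          ∎
  where
  recipℤ[k-[k-i]]≡recipℕ : ∀ i → 1 ℕ.≤ i → i ℕ.≤ K → recipℤ (+ suc K ℤ.- + (suc K ℕ.∸ i)) ≡ recipℕ i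
  recipℤ[k-[k-i]]≡recipℕ i _ i≤K =
    trans (recipℤ[+m-+n]≡recipℕ[m∸n] (ℕ.m∸n≤m (suc K) i)) (cong recipℕ (ℕ.m∸[m∸n]≡n (ℕ.m≤n⇒m≤1+n i≤K)))

module _ {x y r : ℚ} (r*[x-y]≡x*y : r * (x - y) ≡ x * y) where

  x*r≡y*[x+r] : x * r ≡ y * (x + r)
  x*r≡y*[x+r] = begin
    x * r                 ≡⟨ solve 3 (λ x y r → x :* r := r :* (x :- y) :+ y :* r) refl x y r ⟩
    r * (x - y) + y * r   ≡⟨ cong (_+ y * r) r*[x-y]≡x*y ⟩
    x * y + y * r         ≡⟨ solve 3 (λ x y r → x :* y :+ y :* r := y :* (x :+ r)) refl x y r ⟩
    y * (x + r)           ∎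

  partialFractions : ∀ L →
    x ^ suc L * r ≡ sumFrom1 (λ j → x ^ (suc (suc L) ℕ.∸ j) * y ^ j) L + y ^ suc L * (x + r)
  partialFractions zero = begin
    x * 1ℚ * r              ≡⟨ cong (_* r) (*-identityʳ x) ⟩
    x * r                   ≡⟨ x*r≡y*[x+r] ⟩
    y * (x + r)             ≡⟨ solve 3 (λ x y r → y :* (x :+ r) := con 0ℚ :+ y :* con 1ℚ :* (x :+ r)) refl x y r ⟩
    0ℚ + y * 1ℚ * (x + r)   ∎
  partialFractions (suc L) = begin
    x * x ^ suc L * r                         ≡⟨ *-assoc x (x ^ suc L) r ⟩
    x * (x ^ suc L * r)                       ≡⟨ cong (x *_) (partialFractions L) ⟩
    x * (S + y ^ suc L * (x + r))             ≡⟨ solve 5 (λ x y r s b → x :* (s :+ b :* (x :+ r)) := x :* s :+ x :* (x :* con 1ℚ) :* b :+ b :* (x :* r)) refl x y r S (y ^ suc L) ⟩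
    x * S + x ^ 2 * y ^ suc L + y ^ suc L * (x * r)
                                              ≡⟨ cong₂ (λ u v → u + x ^ 2 * y ^ suc L + y ^ suc L * v) x*S≡S′ x*r≡y*[x+r] ⟩
    S′ + x ^ 2 * y ^ suc L + y ^ suc L * (y * (x + r))
                                              ≡⟨ solve 5 (λ x y r s b → s :+ x :* (x :* con 1ℚ) :* b :+ b :* (y :* (x :+ r)) := s :+ x :* (x :* con 1ℚ) :* b :+ y :* b :* (x :+ r)) refl x y r S′ (y ^ suc L) ⟩
    S′ + x ^ 2 * y ^ suc L + y ^ suc (suc L) * (x + r)
                                              ≡⟨ cong (λ e → S′ + x ^ e * y ^ suc L + y ^ suc (suc L) * (x + r)) (ℕ.m+n∸n≡m 2 L) ⟨
    S′ + x ^ (3 ℕ.+ L ℕ.∸ suc L) * y ^ suc L + y ^ suc (suc L) * (x + r) ∎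
    where
    S S′ : ℚ
    S  = sumFrom1 (λ j → x ^ (suc (suc L) ℕ.∸ j) * y ^ j) L
    S′ = sumFrom1 (λ j → x ^ (3 ℕ.+ L ℕ.∸ j) * y ^ j) L
    x*S≡S′ : x * S ≡ S′
    x*S≡S′ = trans (*-distribˡ-sumFrom1 x _ L) (sumFrom1-cong L λ j _ j≤L →
      trans (sym (*-assoc x _ _)) (cong (λ e → x ^ e * y ^ j) (sym (ℕ.+-∸-assoc 1 (ℕ.m≤n⇒m≤1+n (ℕ.m≤n⇒m≤1+n j≤L))))))

recipℕ-archimedean : ∀ ε → 0ℚ < ε → ∃[ d ] recipℕ (suc d) ≤ ε
recipℕ-archimedean (mkℚ (+ zero) _ _) (*<* 0<0)   = ⊥-elim (ℤ.<-irrefl refl 0<0)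
recipℕ-archimedean (mkℚ -[1+ _ ] _ _) (*<* 0<neg) = ⊥-elim (ℤ.<-asym 0<neg ℤ.-<+)
recipℕ-archimedean ε@(mkℚ (+ suc p) q _) _ = q , subst (_≤ ε) (sym (recipℕ≡mkℚ q))
  (*≤* (subst₂ ℤ._≤_ (sym (ℤ.pos-* 1 (suc q))) (sym (ℤ.pos-* (suc p) (suc q))) (ℤ.+≤+ (ℕ.*-monoˡ-≤ (suc q) {1} {suc p} ℕ.z<s))))

m+k≤n⇒m≤n∸k×n∸k+k≡n : ∀ {m n} k → m ℕ.+ k ℕ.≤ n → m ℕ.≤ n ℕ.∸ k × n ℕ.∸ k ℕ.+ k ≡ n
m+k≤n⇒m≤n∸k×n∸k+k≡n {m} {n} k m+k≤n =
  subst (ℕ._≤ n ℕ.∸ k) (ℕ.m+n∸n≡m m k) (ℕ.∸-monoˡ-≤ k m+k≤n) , ℕ.m∸n+n≡m (ℕ.≤-trans (ℕ.m≤n+m k m) m+k≤n)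

module _ (s : ℕ → ℚ) (k : ℕ)
         (step-nonNeg : ∀ b → 0ℚ ≤ s (b ℕ.+ k) - s (suc b ℕ.+ k))
         (step-≤ : ∀ b → s (b ℕ.+ k) - s (suc b ℕ.+ k) ≤ recipℕ (suc b) - recipℕ (suc (suc b))) where

  private
    t : ℕ → ℚ
    t b = s (b ℕ.+ k)

  telescoping-bounds : ∀ a c → 0ℚ ≤ t a - t (c ℕ.+ a) × t a - t (c ℕ.+ a) ≤ recipℕ (suc a) - recipℕ (suc (c ℕ.+ a))
  telescoping-bounds a zero = ≤-reflexive (sym (+-inverseʳ (t a))) , ≤-reflexive (trans (+-inverseʳ (t a)) (sym (+-inverseʳ (recipℕ (suc a)))))
  telescoping-bounds a (suc c) with telescoping-bounds a c
  ... | lower , upper = subst (0ℚ ≤_) (sym split) (+-mono-≤ lower (step-nonNeg b))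
                      , subst (_≤ _) (sym split) (≤-trans (+-mono-≤ upper (step-≤ b)) (≤-reflexive telescope))
    where
    b : ℕ
    b = c ℕ.+ a
    split : t a - t (suc b) ≡ (t a - t b) + (t b - t (suc b))
    split = solve 3 (λ x y z → x :- z := (x :- y) :+ (y :- z)) refl (t a) (t b) (t (suc b))
    telescope : (recipℕ (suc a) - recipℕ (suc b)) + (recipℕ (suc b) - recipℕ (suc (suc b))) ≡ recipℕ (suc a) - recipℕ (suc (suc b))
    telescope = solve 3 (λ x y z → (x :- y) :+ (y :- z) := x :- z) refl (recipℕ (suc a)) (recipℕ (suc b)) (recipℕ (suc (suc b)))

  ∣t-t∣≤ : ∀ d a c → d ℕ.≤ a → ∣ t a - t (c ℕ.+ a) ∣ ≤ recipℕ (suc d)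
  ∣t-t∣≤ d a c d≤a with telescoping-bounds a c
  ... | lower , upper rewrite 0≤p⇒∣p∣≡p lower = ≤-trans upper (≤-trans
    (p-q≤p (recipℕ (suc a)) (recipℕ-nonNeg (suc (c ℕ.+ a))))
    (recipℕ-antimono ℕ.z<s (ℕ.s≤s d≤a)))
    where
    p-q≤p : ∀ p {q} → 0ℚ ≤ q → p - q ≤ p
    p-q≤p p q≥0 = ≤-trans (+-monoʳ-≤ p (neg-antimono-≤ q≥0)) (≤-reflexive (+-identityʳ p))

  decreasing-telescoping⇒IsCauchy : IsCauchy s
  decreasing-telescoping⇒IsCauchy ε ε>0 with recipℕ-archimedean ε ε>0
  ... | d , 1/[1+d]≤ε = d ℕ.+ k , λ N N′ d+k≤N d+k≤N′ → ≤-trans (∣s-s∣≤ N N′ d+k≤N d+k≤N′) 1/[1+d]≤ε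
    where
    ∣s-s∣≤ : ∀ N N′ → d ℕ.+ k ℕ.≤ N → d ℕ.+ k ℕ.≤ N′ → ∣ s N - s N′ ∣ ≤ recipℕ (suc d)
    ∣s-s∣≤ N N′ d+k≤N d+k≤N′ with m+k≤n⇒m≤n∸k×n∸k+k≡n k d+k≤N | m+k≤n⇒m≤n∸k×n∸k+k≡n k d+k≤N′ | ℕ.≤-total (N ℕ.∸ k) (N′ ℕ.∸ k)
    ... | d≤a , a+k≡N | _ , a′+k≡N′ | inj₁ a≤a′ = subst (_≤ recipℕ (suc d))
      (cong₂ (λ x y → ∣ s x - s y ∣) a+k≡N (trans (cong (ℕ._+ k) (ℕ.m∸n+n≡m a≤a′)) a′+k≡N′))
      (∣t-t∣≤ d (N ℕ.∸ k) (N′ ℕ.∸ k ℕ.∸ (N ℕ.∸ k)) d≤a)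
    ... | _ , a+k≡N | d≤a′ , a′+k≡N′ | inj₂ a′≤a = subst (_≤ recipℕ (suc d))
      (trans (cong₂ (λ x y → ∣ s x - s y ∣) a′+k≡N′ (trans (cong (ℕ._+ k) (ℕ.m∸n+n≡m a′≤a)) a+k≡N)) (∣p-q∣≡∣q-p∣ (s N′) (s N)))
      (∣t-t∣≤ d (N′ ℕ.∸ k) (N ℕ.∸ k ℕ.∸ (N′ ℕ.∸ k)) d≤a′)

≈ℝ-from-bound : ∀ (s t : ℕ → ℚ) k .{{_ : ℕ.NonZero k}} →
  (∀ a → ∣ s (a ℕ.+ k) - t (a ℕ.+ k) ∣ ≤ fromℕ k * recipℕ (suc a)) → s ≈ℝ t
≈ℝ-from-bound s t k bound ε ε>0 with recipℕ-archimedean ε ε>0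
... | d , 1/[1+d]≤ε = k ℕ.* suc d ℕ.+ k , λ N M≤N → subst (_≤ ε) (cong (λ x → ∣ s x - t x ∣) (proj₂ (m+k≤n⇒m≤n∸k×n∸k+k≡n k M≤N)))
  (≤-trans (bound (N ℕ.∸ k)) (≤-trans (k/[1+a]≤1/[1+d] (ℕ.≤-trans (proj₁ (m+k≤n⇒m≤n∸k×n∸k+k≡n k M≤N)) (ℕ.n≤1+n _))) 1/[1+d]≤ε))
  where
  1≤k[1+d] : 1 ℕ.≤ k ℕ.* suc d
  1≤k[1+d] = ℕ.≤-trans (ℕ.>-nonZero⁻¹ k) (ℕ.m≤m*n k (suc d))
  k/[1+a]≤1/[1+d] : ∀ {a} → k ℕ.* suc d ℕ.≤ suc a → fromℕ k * recipℕ (suc a) ≤ recipℕ (suc d)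
  k/[1+a]≤1/[1+d] k[1+d]≤1+a = ≤-trans
    (*-monoˡ-≤-nonNeg (fromℕ k) {{nonNegative (fromℕ-nonNeg k)}} (recipℕ-antimono 1≤k[1+d] k[1+d]≤1+a))
    (≤-reflexive (begin
      fromℕ k * recipℕ (k ℕ.* suc d)              ≡⟨ cong (fromℕ k *_) (recipℕ-* k (suc d)) ⟩
      fromℕ k * (recipℕ k * recipℕ (suc d))       ≡⟨ solve 3 (λ a r s → a :* (r :* s) := (r :* a) :* s) refl (fromℕ k) (recipℕ k) (recipℕ (suc d)) ⟩
      (recipℕ k * fromℕ k) * recipℕ (suc d)       ≡⟨ cong (_* recipℕ (suc d)) (recipℕ-inverseˡ k) ⟩
      1ℚ * recipℕ (suc d)                         ≡⟨ *-identityˡ _ ⟩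
      recipℕ (suc d)                              ∎))

lhsTerm-≢ : ∀ {n k i} → i ≢ k → lhsTerm n k i ≡ recipℕ (i ℕ.^ (2 ℕ.* n)) * recipℤ (+ k ℤ.- + i)
lhsTerm-≢ {n} {k} {i} i≢k with i ℕ.≟ k
... | yes i≡k = ⊥-elim (i≢k i≡k)
... | no  _   = refl

lhsTerm-diagonal : ∀ n k → lhsTerm n k k ≡ 0ℚ
lhsTerm-diagonal n k with k ℕ.≟ k
... | yes _   = refl
... | no  k≢k = ⊥-elim (k≢k refl)

module Expansion (n-1 k-1 : ℕ) where

  n k m L : ℕ
  n = suc n-1
  k = suc k-1
  m = 2 ℕ.* n
  L = m ℕ.∸ 1

  k⁻ᵐ k⁻ᵐ⁻¹ : ℚ
  k⁻ᵐ   = recipℕ (k ℕ.^ m)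
  k⁻ᵐ⁻¹ = recipℕ (k ℕ.^ (m ℕ.+ 1))

  rhsHead : ℚ
  rhsHead = H k * k⁻ᵐ - fromℕ (m ℕ.+ 1) * k⁻ᵐ⁻¹

  -- principalPart i is the share of the i-th summand in Σ_j ζ(m+1−j)/k^j, and window a = H_{a+k} − H_a.
  principalPart : ℕ → ℚ
  principalPart i = sumFrom1 (λ j → recipℕ (i ℕ.^ (m ℕ.+ 1 ℕ.∸ j)) * recipℕ (k ℕ.^ j)) L

  residual : ℕ → ℚ
  residual i = lhsTerm n k i - principalPart i

  window : ℕ → ℚ
  window a = sumFrom1 (λ j → recipℕ (a ℕ.+ j)) k

  zetaPart : ℕ → ℚ
  zetaPart N = sumFrom1 (λ j → zetaPartial (m ℕ.+ 1 ℕ.∸ j) N * recipℕ (k ℕ.^ j)) L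

  recipℤ[k-[1+b+k]] : ∀ b → recipℤ (+ k ℤ.- + suc (b ℕ.+ k)) ≡ - recipℕ (suc b)
  recipℤ[k-[1+b+k]] b = trans (recipℤ[+m-+n]≡-recipℕ[n∸m] (ℕ.m≤n+m k (suc b))) (cong (λ d → - recipℕ d) (ℕ.m+n∸n≡m (suc b) k))

  residual-≢ : ∀ i .{{_ : ℕ.NonZero i}} → i ≢ k → residual i ≡ k⁻ᵐ * (recipℕ i + recipℤ (+ k ℤ.- + i))
  residual-≢ i i≢k = begin
    lhsTerm n k i - principalPart i ≡⟨ cong₂ _-_ lhsTerm-expansion principalPart-powers ⟩
    (P + y ^ m * (x + r)) - P       ≡⟨ solve 2 (λ p q → (p :+ q) :- p := q) refl P (y ^ m * (x + r)) ⟩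
    y ^ m * (x + r)                 ≡⟨ cong (_* (x + r)) (recipℕ-^ k m) ⟨
    k⁻ᵐ * (x + r)                   ∎
    where
    x y r P : ℚ
    x = recipℕ i
    y = recipℕ k
    r = recipℤ (+ k ℤ.- + i)
    P = sumFrom1 (λ j → x ^ (suc m ℕ.∸ j) * y ^ j) L
    lhsTerm-expansion : lhsTerm n k i ≡ P + y ^ m * (x + r)
    lhsTerm-expansion = begin
      lhsTerm n k i        ≡⟨ lhsTerm-≢ i≢k ⟩
      recipℕ (i ℕ.^ m) * r ≡⟨ cong (_* r) (recipℕ-^ i m) ⟩
      x ^ m * r            ≡⟨ partialFractions (recipℤ[k-i]*[1/i-1/k]≡1/i*1/k i≢k) L ⟩
      P + y ^ m * (x + r)  ∎
    principalPart-powers : principalPart i ≡ P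
    principalPart-powers = sumFrom1-cong L λ j _ _ →
      cong₂ _*_ (trans (cong (λ e → recipℕ (i ℕ.^ (e ℕ.∸ j))) (ℕ.+-comm m 1)) (recipℕ-^ i (suc m ℕ.∸ j))) (recipℕ-^ k j)

  k⁻ᵐ⁻¹≡k⁻ᵐ*1/k : k⁻ᵐ⁻¹ ≡ k⁻ᵐ * recipℕ k
  k⁻ᵐ⁻¹≡k⁻ᵐ*1/k = begin
    recipℕ (k ℕ.^ (m ℕ.+ 1))       ≡⟨ cong recipℕ (ℕ.^-distribˡ-+-* k m 1) ⟩
    recipℕ (k ℕ.^ m ℕ.* (k ℕ.* 1)) ≡⟨ recipℕ-* (k ℕ.^ m) (k ℕ.* 1) ⟩
    k⁻ᵐ * recipℕ (k ℕ.* 1)         ≡⟨ cong (λ c → k⁻ᵐ * recipℕ c) (ℕ.*-identityʳ k) ⟩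
    k⁻ᵐ * recipℕ k                 ∎

  residual-diagonal : residual k ≡ - (fromℕ L * k⁻ᵐ⁻¹)
  residual-diagonal = begin
    lhsTerm n k k - principalPart k ≡⟨ cong₂ _-_ (lhsTerm-diagonal n k) (trans (sumFrom1-cong L k^-[m+1-j]*k^-j≡k⁻ᵐ⁻¹) (sumFrom1-const k⁻ᵐ⁻¹ L)) ⟩
    0ℚ - fromℕ L * k⁻ᵐ⁻¹            ≡⟨ +-identityˡ _ ⟩
    - (fromℕ L * k⁻ᵐ⁻¹)             ∎
    where
    k^-[m+1-j]*k^-j≡k⁻ᵐ⁻¹ : ∀ j → 1 ℕ.≤ j → j ℕ.≤ L → recipℕ (k ℕ.^ (m ℕ.+ 1 ℕ.∸ j)) * recipℕ (k ℕ.^ j) ≡ k⁻ᵐ⁻¹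
    k^-[m+1-j]*k^-j≡k⁻ᵐ⁻¹ j _ j≤L = begin
      recipℕ (k ℕ.^ (m ℕ.+ 1 ℕ.∸ j)) * recipℕ (k ℕ.^ j) ≡⟨ recipℕ-* (k ℕ.^ (m ℕ.+ 1 ℕ.∸ j)) (k ℕ.^ j) ⟨
      recipℕ (k ℕ.^ (m ℕ.+ 1 ℕ.∸ j) ℕ.* k ℕ.^ j)       ≡⟨ cong recipℕ (ℕ.^-distribˡ-+-* k (m ℕ.+ 1 ℕ.∸ j) j) ⟨
      recipℕ (k ℕ.^ (m ℕ.+ 1 ℕ.∸ j ℕ.+ j))             ≡⟨ cong (λ e → recipℕ (k ℕ.^ e)) (ℕ.m∸n+n≡m (ℕ.≤-trans j≤L (ℕ.≤-trans (ℕ.n≤1+n L) (ℕ.m≤m+n m 1)))) ⟩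
      k⁻ᵐ⁻¹                                              ∎

  window-suc : ∀ a → window (suc a) ≡ window a + recipℕ (suc (a ℕ.+ k)) - recipℕ (suc a)
  window-suc a = begin
    window (suc a)                                      ≡⟨ solve 2 (λ w r → w := w :+ r :- r) refl (window (suc a)) (recipℕ (suc a)) ⟩
    window (suc a) + recipℕ (suc a) - recipℕ (suc a)    ≡⟨ cong (_- recipℕ (suc a)) (cong₂ _+_ (sumFrom1-cong k (λ j _ _ → cong recipℕ (sym (ℕ.+-suc a j)))) (cong recipℕ (ℕ.+-comm 1 a))) ⟩
    sumFrom1 (λ j → g (suc j)) k + g 1 - recipℕ (suc a) ≡⟨ cong (_- recipℕ (suc a)) (sumFrom1-shift g k) ⟩
    window a + g (suc k) - recipℕ (suc a)               ≡⟨ cong (λ c → window a + recipℕ c - recipℕ (suc a)) (ℕ.+-suc a k) ⟩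
    window a + recipℕ (suc (a ℕ.+ k)) - recipℕ (suc a)  ∎
    where
    g : ℕ → ℚ
    g j = recipℕ (a ℕ.+ j)

  fromℕ[m+1]≡L+2 : fromℕ (m ℕ.+ 1) ≡ fromℕ L + 1ℚ + 1ℚ
  fromℕ[m+1]≡L+2 = trans (fromℕ-+ (suc L) 1) (cong (_+ 1ℚ) (fromℕ-suc L))

  sumFrom1-residual : ∀ a → sumFrom1 residual (a ℕ.+ k) ≡ rhsHead + k⁻ᵐ * window a
  sumFrom1-residual zero = begin
    sumFrom1 residual k-1 + residual k               ≡⟨ cong₂ _+_ residual-below-k residual-diagonal ⟩
    k⁻ᵐ * (h + h) + - (fromℕ L * k⁻ᵐ⁻¹)              ≡⟨ cong (λ w → k⁻ᵐ * (h + h) + - (fromℕ L * w)) k⁻ᵐ⁻¹≡k⁻ᵐ*1/k ⟩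
    k⁻ᵐ * (h + h) + - (fromℕ L * (k⁻ᵐ * y))          ≡⟨ solve 4 (λ c h y l → c :* (h :+ h) :+ :- (l :* (c :* y)) := (h :+ y) :* c :- (l :+ con 1ℚ :+ con 1ℚ) :* (c :* y) :+ c :* (h :+ y)) refl k⁻ᵐ h y (fromℕ L) ⟩
    (h + y) * k⁻ᵐ - (fromℕ L + 1ℚ + 1ℚ) * (k⁻ᵐ * y) + k⁻ᵐ * (h + y)
                                                     ≡⟨ cong₂ (λ u w → (h + y) * k⁻ᵐ - u * w + k⁻ᵐ * (h + y)) fromℕ[m+1]≡L+2 k⁻ᵐ⁻¹≡k⁻ᵐ*1/k ⟨
    rhsHead + k⁻ᵐ * window zero                      ∎
    where
    h y : ℚ
    h = H k-1
    y = recipℕ k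
    residual-below-k : sumFrom1 residual k-1 ≡ k⁻ᵐ * (h + h)
    residual-below-k = begin
      sumFrom1 residual k-1                                         ≡⟨ sumFrom1-cong k-1 (λ i 1≤i i≤k-1 → residual-≢ i {{ℕ.>-nonZero 1≤i}} (ℕ.<⇒≢ (ℕ.s≤s i≤k-1))) ⟩
      sumFrom1 (λ i → k⁻ᵐ * (recipℕ i + recipℤ (+ k ℤ.- + i))) k-1  ≡⟨ *-distribˡ-sumFrom1 k⁻ᵐ _ k-1 ⟨
      k⁻ᵐ * sumFrom1 (λ i → recipℕ i + recipℤ (+ k ℤ.- + i)) k-1    ≡⟨ cong (k⁻ᵐ *_) (sumFrom1-+ recipℕ _ k-1) ⟩
      k⁻ᵐ * (h + sumFrom1 (λ i → recipℤ (+ k ℤ.- + i)) k-1)         ≡⟨ cong (λ s → k⁻ᵐ * (h + s)) (sumFrom1-recipℤ[k-i]≡H k-1) ⟩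
      k⁻ᵐ * (h + h)                                                  ∎
  sumFrom1-residual (suc a) = begin
    sumFrom1 residual (a ℕ.+ k) + residual i                            ≡⟨ cong₂ _+_ (sumFrom1-residual a) (residual-≢ i (≢-sym (ℕ.<⇒≢ (ℕ.s≤s (ℕ.m≤n+m k a))))) ⟩
    rhsHead + k⁻ᵐ * window a + k⁻ᵐ * (recipℕ i + recipℤ (+ k ℤ.- + i)) ≡⟨ cong (λ z → rhsHead + k⁻ᵐ * window a + k⁻ᵐ * (recipℕ i + z)) (recipℤ[k-[1+b+k]] a) ⟩
    rhsHead + k⁻ᵐ * window a + k⁻ᵐ * (recipℕ i + - ρ)                   ≡⟨ solve 5 (λ h c w x ρ → h :+ c :* w :+ c :* (x :+ :- ρ) := h :+ c :* (w :+ x :- ρ)) refl rhsHead k⁻ᵐ (window a) (recipℕ i) ρ ⟩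
    rhsHead + k⁻ᵐ * (window a + recipℕ i - ρ)                           ≡⟨ cong (λ w → rhsHead + k⁻ᵐ * w) (window-suc a) ⟨
    rhsHead + k⁻ᵐ * window (suc a)                                      ∎
    where
    i : ℕ
    i = suc (a ℕ.+ k)
    ρ : ℚ
    ρ = recipℕ (suc a)

  zetaPart≡sumFrom1-principalPart : ∀ N → zetaPart N ≡ sumFrom1 principalPart N
  zetaPart≡sumFrom1-principalPart N =
    trans (sumFrom1-cong L (λ j _ _ → *-distribʳ-sumFrom1 (recipℕ (k ℕ.^ j)) (λ i → recipℕ (i ℕ.^ (m ℕ.+ 1 ℕ.∸ j))) N))
          (sumFrom1-comm (λ i j → recipℕ (i ℕ.^ (m ℕ.+ 1 ℕ.∸ j)) * recipℕ (k ℕ.^ j)) N L)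

  lhsPartial-rhsApprox : ∀ a → lhsPartial n k (a ℕ.+ k) - rhsApprox n k (a ℕ.+ k) ≡ k⁻ᵐ * window a
  lhsPartial-rhsApprox a = begin
    lhsPartial n k N - rhsApprox n k N                               ≡⟨ cong (_- rhsApprox n k N) lhsPartial-split ⟩
    (sumFrom1 residual N + zetaPart N) - (rhsHead + zetaPart N)      ≡⟨ cong (λ s → (s + zetaPart N) - (rhsHead + zetaPart N)) (sumFrom1-residual a) ⟩
    (rhsHead + k⁻ᵐ * window a + zetaPart N) - (rhsHead + zetaPart N)  ≡⟨ solve 3 (λ h t z → (h :+ t :+ z) :- (h :+ z) := t) refl rhsHead (k⁻ᵐ * window a) (zetaPart N) ⟩
    k⁻ᵐ * window a                                                   ∎
    where
    N : ℕ
    N = a ℕ.+ k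
    lhsPartial-split : lhsPartial n k N ≡ sumFrom1 residual N + zetaPart N
    lhsPartial-split = begin
      lhsPartial n k N                                                         ≡⟨ solve 2 (λ l p → l := (l :- p) :+ p) refl (lhsPartial n k N) (sumFrom1 principalPart N) ⟩
      (lhsPartial n k N - sumFrom1 principalPart N) + sumFrom1 principalPart N ≡⟨ cong₂ _+_ (sumFrom1-difference (lhsTerm n k) principalPart N) (zetaPart≡sumFrom1-principalPart N) ⟨
      sumFrom1 residual N + zetaPart N                                         ∎

  lhsPartial-step : ∀ b → lhsPartial n k (b ℕ.+ k) - lhsPartial n k (suc b ℕ.+ k) ≡ recipℕ (suc (b ℕ.+ k) ℕ.^ m) * recipℕ (suc b)
  lhsPartial-step b = begin
    l - (l + lhsTerm n k i)                       ≡⟨ solve 2 (λ l x → l :- (l :+ x) := :- x) refl l (lhsTerm n k i) ⟩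
    - lhsTerm n k i                               ≡⟨ cong -_ (lhsTerm-≢ (≢-sym (ℕ.<⇒≢ (ℕ.s≤s (ℕ.m≤n+m k b))))) ⟩
    - (recipℕ (i ℕ.^ m) * recipℤ (+ k ℤ.- + i))   ≡⟨ cong (λ z → - (recipℕ (i ℕ.^ m) * z)) (recipℤ[k-[1+b+k]] b) ⟩
    - (recipℕ (i ℕ.^ m) * - recipℕ (suc b))       ≡⟨ solve 2 (λ x y → :- (x :* :- y) := x :* y) refl (recipℕ (i ℕ.^ m)) (recipℕ (suc b)) ⟩
    recipℕ (i ℕ.^ m) * recipℕ (suc b)             ∎
    where
    l : ℚ
    l = lhsPartial n k (b ℕ.+ k)
    i : ℕ
    i = suc (b ℕ.+ k)

  lhsPartial-step-nonNeg : ∀ b → 0ℚ ≤ lhsPartial n k (b ℕ.+ k) - lhsPartial n k (suc b ℕ.+ k)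
  lhsPartial-step-nonNeg b = subst (0ℚ ≤_) (sym (lhsPartial-step b)) (*-nonNeg (recipℕ-nonNeg (suc (b ℕ.+ k) ℕ.^ m)) (recipℕ-nonNeg (suc b)))

  lhsPartial-step-≤ : ∀ b → lhsPartial n k (b ℕ.+ k) - lhsPartial n k (suc b ℕ.+ k) ≤ recipℕ (suc b) - recipℕ (suc (suc b))
  lhsPartial-step-≤ b = subst₂ _≤_ (sym (lhsPartial-step b)) (trans (*-comm (recipℕ (2 ℕ.+ b)) (recipℕ (suc b))) (recipℕ-telescope b))
    (*-monoʳ-≤-nonNeg (recipℕ (suc b)) {{nonNegative (recipℕ-nonNeg (suc b))}} (recipℕ-antimono ℕ.z<s 2+b≤i^m))
    where
    i : ℕ
    i = suc (b ℕ.+ k)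
    2+b≤i^m : 2 ℕ.+ b ℕ.≤ i ℕ.^ m
    2+b≤i^m = ℕ.≤-trans (ℕ.s≤s (subst (suc b ℕ.≤_) (sym (ℕ.+-suc b k-1)) (ℕ.s≤s (ℕ.m≤m+n b k-1))))
                        (subst (ℕ._≤ i ℕ.^ m) (ℕ.^-identityʳ i) (ℕ.^-monoʳ-≤ i {1} {m} ℕ.z<s))

  window-≤ : ∀ a → window a ≤ fromℕ k * recipℕ (suc a)
  window-≤ a = sumFrom1-≤ _ (recipℕ (suc a)) k λ j 1≤j _ →
    recipℕ-antimono ℕ.z<s (subst (ℕ._≤ a ℕ.+ j) (ℕ.+-comm a 1) (ℕ.+-monoʳ-≤ a 1≤j))

  window-nonNeg : ∀ a → 0ℚ ≤ window a
  window-nonNeg a = sumFrom1-nonNeg _ k (λ j _ _ → recipℕ-nonNeg (a ℕ.+ j))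

  ∣lhsPartial-rhsApprox∣≤ : ∀ a → ∣ lhsPartial n k (a ℕ.+ k) - rhsApprox n k (a ℕ.+ k) ∣ ≤ fromℕ k * recipℕ (suc a)
  ∣lhsPartial-rhsApprox∣≤ a = subst (_≤ fromℕ k * recipℕ (suc a)) (sym ∣lhsPartial-rhsApprox∣≡)
    (≤-trans (subst (k⁻ᵐ * window a ≤_) (*-identityˡ (window a)) k⁻ᵐ*window≤1*window) (window-≤ a))
    where
    ∣lhsPartial-rhsApprox∣≡ : ∣ lhsPartial n k (a ℕ.+ k) - rhsApprox n k (a ℕ.+ k) ∣ ≡ k⁻ᵐ * window a
    ∣lhsPartial-rhsApprox∣≡ = trans (cong ∣_∣ (lhsPartial-rhsApprox a)) (0≤p⇒∣p∣≡p (*-nonNeg (recipℕ-nonNeg (k ℕ.^ m)) (window-nonNeg a)))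
    k⁻ᵐ*window≤1*window : k⁻ᵐ * window a ≤ 1ℚ * window a
    k⁻ᵐ*window≤1*window = *-monoʳ-≤-nonNeg (window a) {{nonNegative (window-nonNeg a)}} (recipℕ≤1 (k ℕ.^ m))

lemma2 : (n k : ℕ) → n ≥ 1 → k ≥ 1 →
    IsCauchy (lhsPartial n k) × (lhsPartial n k ≈ℝ rhsApprox n k)
lemma2 (suc n-1) (suc k-1) _ _ =
    decreasing-telescoping⇒IsCauchy (lhsPartial n k) k lhsPartial-step-nonNeg lhsPartial-step-≤
  , ≈ℝ-from-bound (lhsPartial n k) (rhsApprox n k) k ∣lhsPartial-rhsApprox∣≤
  where open Expansion n-1 k-1
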